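{- Let $r\ge 2$, let $R$ and $S$ be rings with unity with $R$ an $S$-module, let $\vec\lambda=(\lambda_1,\dots,\lambda_r)\in S^r$, and let $R'\subseteq R$ and $A\subseteq R$ be finite. If the hypergraph $\mathcal{H}(A,\vec\lambda)$ contains a Berge cycle of length $k$, then there are indices $i_1,i_2,\dots,i_k\in\{1,\dots,r\}$ with $i_\ell\neq i_{\ell+1}$ for $1\le \ell\le k-1$ and $i_k\neq i_1$, and elements $a_1,\dots,a_k\in A$, such that \[ (\lambda_{i_2} - \lambda_{i_1})a_1 + (\lambda_{i_3}- \lambda_{i_2})a_2 + \cdots + (\lambda_{i_k} - \lambda_{i_{k-1}})a_{k-1} + (\lambda_{i_1} - \lambda_{i_k})a_k = 0. \]
   Context: $\mathcal{H}(A,\vec\lambda)$ is the $r$-uniform $r$-partite hypergraph whose vertices are pairs $(y,i)$ with $y\in R$, $i\in\{1,\dots,r\}$ (the $i$-th part being $R'\times\{i\}$), and whose edge set is $\{e(x,a): x\in R', a\in A\}$, where $e(x,a)=\{(x+\lambda_1 a,1),(x+\lambda_2 a,2),\dots,(x+\lambda_r a,r)\}$. A Berge cycle of length $k\ge 2$ is a sequence of $k$ distinct vertices $v_1,\dots,v_k$ and $k$ distinct edges $E_1,\dots,E_k$ with $\{v_i,v_{i+1}\}\subseteq E_i$ for all $i$, indices modulo $k$. -}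

module Defs where

open import Level using (Level; _⊔_)
open import Data.Nat using (ℕ; suc; NonZero)
open import Data.Nat.DivMod using (_%_; m%n<n)
open import Data.Fin using (Fin; toℕ; fromℕ<)
open import Data.Product using (_×_; Σ; ∃; _,_)
open import Data.List using (List)
open import Relation.Nullary using (¬_)
open import Relation.Binary.PropositionalEquality using (_≡_; _≢_)
open import Algebra.Bundles using (Ring)
open import Algebra.Module.Structures using (IsLeftModule)
import Data.List.Membership.Setoid as SetoidMembership

next : ∀ {k} .{{_ : NonZero k}} → Fin k → Fin k
next {k} ℓ = fromℕ< (m%n<n (suc (toℕ ℓ)) k)

module Setting {c₁ ℓ₁ c₂ ℓ₂ : Level}
  (R : Ring c₁ ℓ₁) (S : Ring c₂ ℓ₂)
  (_·_ : Ring.Carrier S → Ring.Carrier R → Ring.Carrier R)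
  (isModule : IsLeftModule S (Ring._≈_ R) (Ring._+_ R) (Ring.0# R) (Ring.-_ R) _·_)
  (r : ℕ) (λv : Fin r → Ring.Carrier S)
  (R′ A : List (Ring.Carrier R))
  where

  open Ring R using (Carrier; _≈_; _+_; 0#)
  private module S = Ring S
  open SetoidMembership (Ring.setoid R) using (_∈_)

  Vertex : Set c₁
  Vertex = Carrier × Fin r

  _≈V_ : Vertex → Vertex → Set ℓ₁
  (y , i) ≈V (y′ , i′) = (y ≈ y′) × (i ≡ i′)

  -- an edge e(x,a) is named by a pair (x , a) with x ∈ R', a ∈ A
  EdgeName : Set (c₁ ⊔ ℓ₁)
  EdgeName = Σ (Carrier × Carrier) (λ { (x , a) → (x ∈ R′) × (a ∈ A) })

  -- membership of a vertex in e(x,a) = {(x + λ₁a,1), …, (x + λᵣa,r)}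
  _∈E_ : Vertex → EdgeName → Set ℓ₁
  (y , i) ∈E ((x , a) , _) = y ≈ (x + (λv i · a))

  -- equality of edges as sets of vertices (each edge has exactly one vertex per part)
  _≈E_ : EdgeName → EdgeName → Set ℓ₁
  ((x , a) , _) ≈E ((x′ , a′) , _) = ∀ i → (x + (λv i · a)) ≈ (x′ + (λv i · a′))

  record BergeCycle (k : ℕ) .{{_ : NonZero k}} : Set (c₁ ⊔ ℓ₁) where
    field
      v : Fin k → Vertex
      E : Fin k → EdgeName
      v-distinct : ∀ p q → p ≢ q → ¬ (v p ≈V v q)
      E-distinct : ∀ p q → p ≢ q → ¬ (E p ≈E E q)
      v∈E : ∀ p → (v p ∈E E p) × (v (next p) ∈E E p)

  sumR : ∀ {k} → (Fin k → Carrier) → Carrier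
  sumR {ℕ.zero} f = 0#
  sumR {suc k} f = f Fin.zero + sumR (λ ℓ → f (Fin.suc ℓ))

  Conclusion : (k : ℕ) .{{_ : NonZero k}} → Set (c₁ ⊔ ℓ₁)
  Conclusion k =
    Σ (Fin k → Fin r) λ ind →
    Σ (Fin k → Carrier) λ a →
      (∀ ℓ → ind ℓ ≢ ind (next ℓ)) ×
      (∀ ℓ → a ℓ ∈ A) ×
      (sumR (λ ℓ → (λv (ind (next ℓ)) S.+ (S.- λv (ind ℓ))) · a ℓ) ≈ 0#)

{-# OPTIONS --safe #-}

-- Write the vertices of the cycle as (y_ℓ , i_ℓ) and its edges as e(x_ℓ , a_ℓ).
-- As v_ℓ and v_{ℓ+1} both lie in e(x_ℓ , a_ℓ), the increment y_{ℓ+1} − y_ℓ equals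
-- (λ_{i_{ℓ+1}} − λ_{i_ℓ}) a_ℓ, and these increments telescope to 0 around the cycle.
-- Consecutive indices differ because an edge meets each part in a single vertex,
-- whereas v_ℓ ≠ v_{ℓ+1} as k ≥ 2.
module Submission where

open import Defs
open import Level using (Level)
open import Data.Nat as ℕ using (ℕ; suc; _≤_; _<_; s≤s; _<?_; NonZero)
open import Data.Nat.Properties using (1+n≢n; ≤-antisym; ≮⇒≥; <-irrefl)
open import Data.Nat.DivMod using (_%_; m<n⇒m%n≡m; n%n≡0)
open import Data.Fin as Fin using (Fin; toℕ; inject₁; fromℕ)
open import Data.Fin.Properties using (toℕ-injective; toℕ-fromℕ<; toℕ-inject₁; toℕ-fromℕ; toℕ<n)
open import Data.List using (List)
open import Data.Product using (_,_; proj₁; proj₂)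
open import Data.Vec.Functional using (Vector)
open import Function using (_∘_)
open import Relation.Nullary using (yes; no)
open import Relation.Binary.PropositionalEquality as ≡ using (_≡_; _≢_)
open import Algebra.Bundles using (CommutativeMonoid; AbelianGroup; Ring)
open import Algebra.Module.Structures using (IsLeftModule)

toℕ-next : ∀ {k} .{{_ : NonZero k}} (ℓ : Fin k) → toℕ (next ℓ) ≡ suc (toℕ ℓ) % k
toℕ-next ℓ = toℕ-fromℕ< _

next-inject₁ : ∀ {m} (j : Fin m) → next (inject₁ j) ≡ Fin.suc j
next-inject₁ {m} j = toℕ-injective (begin
  toℕ (next (inject₁ j))         ≡⟨ toℕ-next (inject₁ j) ⟩
  suc (toℕ (inject₁ j)) % suc m  ≡⟨ ≡.cong (λ n → suc n % suc m) (toℕ-inject₁ j) ⟩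
  suc (toℕ j) % suc m            ≡⟨ m<n⇒m%n≡m (s≤s (toℕ<n j)) ⟩
  suc (toℕ j)                    ∎)
  where open ≡.≡-Reasoning

next-fromℕ : ∀ m → next (fromℕ m) ≡ Fin.zero
next-fromℕ m = toℕ-injective (begin
  toℕ (next (fromℕ m))         ≡⟨ toℕ-next (fromℕ m) ⟩
  suc (toℕ (fromℕ m)) % suc m  ≡⟨ ≡.cong (λ n → suc n % suc m) (toℕ-fromℕ m) ⟩
  suc m % suc m                ≡⟨ n%n≡0 (suc m) ⟩
  0                            ∎)
  where open ≡.≡-Reasoning

n≢[1+n]%k : ∀ {n k} .{{_ : NonZero k}} → 2 ≤ k → n < k → n ≢ suc n % k
n≢[1+n]%k {n} {k} 2≤k n<k n≡[1+n]%k with suc n <? k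
... | yes 1+n<k = 1+n≢n (≡.sym (≡.trans n≡[1+n]%k (m<n⇒m%n≡m 1+n<k)))
... | no 1+n≮k with ≤-antisym n<k (≮⇒≥ 1+n≮k)
...   | ≡.refl with ≡.trans n≡[1+n]%k (n%n≡0 k)
...     | ≡.refl = <-irrefl ≡.refl 2≤k

ℓ≢next[ℓ] : ∀ {k} .{{_ : NonZero k}} → 2 ≤ k → (ℓ : Fin k) → ℓ ≢ next ℓ
ℓ≢next[ℓ] 2≤k ℓ ℓ≡next[ℓ] =
  n≢[1+n]%k 2≤k (toℕ<n ℓ) (≡.trans (≡.cong toℕ ℓ≡next[ℓ]) (toℕ-next ℓ))

module _ {c ℓ} (M : CommutativeMonoid c ℓ) where
  open CommutativeMonoid M
  open import Algebra.Properties.CommutativeMonoid.Sum M using (sum; sum-init-last; sum-cong-≗)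
  open import Relation.Binary.Reasoning.Setoid setoid

  sum-rotate : ∀ {m} (f : Vector Carrier (suc m)) → sum (f ∘ next) ≈ sum f
  sum-rotate {m} f = begin
    sum (f ∘ next)                                 ≈⟨ sum-init-last (f ∘ next) ⟩
    sum (f ∘ next ∘ inject₁) ∙ f (next (fromℕ m))  ≡⟨ ≡.cong₂ _∙_ (sum-cong-≗ (≡.cong f ∘ next-inject₁))
                                                                   (≡.cong f (next-fromℕ m)) ⟩
    sum (f ∘ Fin.suc) ∙ f Fin.zero                 ≈⟨ comm _ _ ⟩
    sum f                                          ∎

module _ {c ℓ} (G : AbelianGroup c ℓ) where
  open AbelianGroup G
  open import Algebra.Properties.AbelianGroup G using (identityˡ-unique)
  open import Algebra.Properties.CommutativeMonoid.Sum commutativeMonoid using (sum; ∑-distrib-+; sum-cong-≋)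
  open import Relation.Binary.Reasoning.Setoid setoid

  sum-cyclic-telescope : ∀ {m} (d y : Vector Carrier (suc m)) →
                         (∀ p → d p ∙ y p ≈ y (next p)) → sum d ≈ ε
  sum-cyclic-telescope d y d∙y≈y∘next = identityˡ-unique (sum d) (sum y) (begin
    sum d ∙ sum y          ≈⟨ ∑-distrib-+ d y ⟨
    sum (λ p → d p ∙ y p)  ≈⟨ sum-cong-≋ d∙y≈y∘next ⟩
    sum (y ∘ next)         ≈⟨ sum-rotate commutativeMonoid y ⟩
    sum y                  ∎)

module _ {c₁ ℓ₁ c₂ ℓ₂ : Level}
  (R : Ring c₁ ℓ₁) (S : Ring c₂ ℓ₂)
  (_·_ : Ring.Carrier S → Ring.Carrier R → Ring.Carrier R)
  (isModule : IsLeftModule S (Ring._≈_ R) (Ring._+_ R) (Ring.0# R) (Ring.-_ R) _·_)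
  where

  open Ring R
  private module S = Ring S
  open IsLeftModule isModule using (*ₗ-distribʳ; *ₗ-cong)
  open import Algebra.Properties.Group S.+-group using (//-rightDividesˡ)
  open import Algebra.Properties.CommutativeSemigroup +-commutativeSemigroup using (x∙yz≈y∙xz)
  open import Relation.Binary.Reasoning.Setoid setoid

  [s-t]·a+t·a≈s·a : ∀ s t a → (s S.- t) · a + t · a ≈ s · a
  [s-t]·a+t·a≈s·a s t a = begin
    (s S.- t) · a + t · a  ≈⟨ *ₗ-distribʳ a (s S.- t) t ⟨
    ((s S.- t) S.+ t) · a  ≈⟨ *ₗ-cong (//-rightDividesˡ t s) refl ⟩
    s · a                  ∎

  translate-difference : ∀ {x y y′} s t a → y ≈ x + t · a → y′ ≈ x + s · a → (s S.- t) · a + y ≈ y′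
  translate-difference {x} {y} {y′} s t a y≈ y′≈ = begin
    (s S.- t) · a + y            ≈⟨ +-congˡ y≈ ⟩
    (s S.- t) · a + (x + t · a)  ≈⟨ x∙yz≈y∙xz _ x _ ⟩
    x + ((s S.- t) · a + t · a)  ≈⟨ +-congˡ ([s-t]·a+t·a≈s·a s t a) ⟩
    x + s · a                    ≈⟨ y′≈ ⟨
    y′                           ∎

  module BergeCycles (r : ℕ) (λv : Fin r → S.Carrier) (R′ A : List Carrier) where
    open Setting R S _·_ isModule r λv R′ A
    open import Data.List.Membership.Setoid setoid using (_∈_)
    open import Algebra.Properties.CommutativeMonoid.Sum +-commutativeMonoid using (sum)

    sumR≡sum : ∀ {k} (f : Vector Carrier k) → sumR f ≡ sum f
    sumR≡sum {ℕ.zero} f = ≡.refl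
    sumR≡sum {suc k} f = ≡.cong (f Fin.zero +_) (sumR≡sum (f ∘ Fin.suc))

    ∈E-unique-in-part : ∀ {u w e} → u ∈E e → w ∈E e → proj₂ u ≡ proj₂ w → u ≈V w
    ∈E-unique-in-part u∈e w∈e ≡.refl = trans u∈e (sym w∈e) , ≡.refl

    module _ {m} (C : BergeCycle (suc m)) where
      open BergeCycle C

      part : Fin (suc m) → Fin r
      part = proj₂ ∘ v

      coefficient : Fin (suc m) → Carrier
      coefficient p = proj₂ (proj₁ (E p))

      coefficient∈A : ∀ p → coefficient p ∈ A
      coefficient∈A p = proj₂ (proj₂ (E p))

      consecutive-parts-differ : 2 ≤ suc m → ∀ p → part p ≢ part (next p)
      consecutive-parts-differ 2≤k p same-part = v-distinct p (next p) (ℓ≢next[ℓ] 2≤k p)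
        (∈E-unique-in-part {e = E p} (proj₁ (v∈E p)) (proj₂ (v∈E p)) same-part)

      increment : Fin (suc m) → Carrier
      increment p = (λv (part (next p)) S.- λv (part p)) · coefficient p

      sum-increments≈0 : sumR increment ≈ 0#
      sum-increments≈0 = begin
        sumR increment  ≡⟨ sumR≡sum increment ⟩
        sum increment   ≈⟨ sum-cyclic-telescope +-abelianGroup increment (proj₁ ∘ v)
                                               increment+y≈y∘next ⟩
        0#              ∎
        where
        increment+y≈y∘next : ∀ p → increment p + proj₁ (v p) ≈ proj₁ (v (next p))
        increment+y≈y∘next p = translate-difference _ _ _ (proj₁ (v∈E p)) (proj₂ (v∈E p))

proposition2p1 : {c₁ ℓ₁ c₂ ℓ₂ : Level}
    (R : Ring c₁ ℓ₁) (S : Ring c₂ ℓ₂)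
    (_·_ : Ring.Carrier S → Ring.Carrier R → Ring.Carrier R)
    (isModule : IsLeftModule S (Ring._≈_ R) (Ring._+_ R) (Ring.0# R) (Ring.-_ R) _·_)
    (r : ℕ) → 2 ≤ r → (λv : Fin r → Ring.Carrier S)
    (R′ A : List (Ring.Carrier R))
    (k : ℕ) .{{_ : NonZero k}} → 2 ≤ k →
    Setting.BergeCycle R S _·_ isModule r λv R′ A k →
    Setting.Conclusion R S _·_ isModule r λv R′ A k
proposition2p1 R S _·_ isModule r _ λv R′ A (suc m) 2≤k C =
  part C , coefficient C , consecutive-parts-differ C 2≤k , coefficient∈A C , sum-increments≈0 C
  where open BergeCycles R S _·_ isModule r λv R′ A
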